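{- Let $I_4=\{1,2,3,4\}$ and let $\mathfrak{N}$ be a Veblen configuration defined on $\wp_2(I_4)$. Then the map $p\mapsto p$, $a_i\mapsto b_i$, $b_i\mapsto a_i$ ($i\in I_4$), $c_u\mapsto c_{\varkappa(u)}$ ($u\in\wp_2(I_4)$) is an isomorphism of $\mathbf{\Pi}(p,\varkappa,\mathfrak{N})$ onto $\mathbf{\Pi}(p,\varkappa,\varkappa(\mathfrak{N}))$.
   Context: $\wp_2(I_4)$ is the set of 2-element subsets of $I_4$; $\varkappa(u)=I_4\setminus u$ for $u\in\wp_2(I_4)$. A Veblen configuration on $\wp_2(I_4)$ is a family of four 3-element subsets of $\wp_2(I_4)$ ("lines") such that every element of $\wp_2(I_4)$ lies on exactly two lines and any two lines meet in exactly one element; $\varkappa(\mathfrak{N})$ is the Veblen configuration whose lines are $\{\varkappa(u):u\in L\}$ for lines $L$ of $\mathfrak{N}$. Take pairwise distinct symbols $p$, $a_i,b_i$ ($i\in I_4$), $c_u$ ($u\in\wp_2(I_4)$). For a bijection $\delta$ of $\wp_2(I_4)$, $\mathbf{\Pi}(p,\delta,\mathfrak{N})$ is the incidence structure with points $p,a_i,b_i,c_u$ and lines: $\{c_u:u\in L\}$ for each line $L$ of $\mathfrak{N}$; $\{a_i,a_j,c_{\{i,j\}}\}$ and $\{b_i,b_j,c_{\delta^{ -1}(\{i,j\})}\}$ for $\{i,j\}\in\wp_2(I_4)$; and $\{p,a_i,b_i\}$ for $i\in I_4$. An isomorphism is a bijection of point sets mapping lines onto lines. -}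

module Defs where

open import Data.Nat using (ℕ; _∸_)
open import Data.Nat.Properties using (≡-irrelevant)
open import Data.Fin using (Fin; zero; suc)
open import Data.Fin.Subset using (Subset; ∁; ∣_∣; _∈_)
open import Data.Fin.Subset.Properties using (∣∁p∣≡n∸∣p∣)
open import Data.Vec using (_∷_; [])
open import Data.Bool using (not)
open import Data.Bool.Properties using (not-involutive)
open import Data.Product using (Σ; _,_; proj₁; proj₂; ∃; ∃!; _×_)
open import Data.Sum using (_⊎_)
open import Function.Bundles using (_↔_; mk↔ₛ′; Inverse)
open import Function.Definitions using (Bijective)
open import Relation.Binary.PropositionalEquality using (_≡_; _≢_; refl; cong; cong₂; trans)

I₄ : Set
I₄ = Fin 4

℘₂ : Set
℘₂ = Σ (Subset 4) (λ u → ∣ u ∣ ≡ 2)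

ϰ : ℘₂ → ℘₂
ϰ (u , eq) = ∁ u , trans (∣∁p∣≡n∸∣p∣ u) (cong (4 ∸_) eq)

private
  ∁∁ : (u : Subset 4) → ∁ (∁ u) ≡ u
  ∁∁ (x₀ ∷ x₁ ∷ x₂ ∷ x₃ ∷ []) =
    cong₂ _∷_ (not-involutive x₀) (cong₂ _∷_ (not-involutive x₁)
      (cong₂ _∷_ (not-involutive x₂) (cong₂ _∷_ (not-involutive x₃) refl)))

ϰ-involutive : (u : ℘₂) → ϰ (ϰ u) ≡ u
ϰ-involutive (u , eq) with ∁ (∁ u) | ∁∁ u | trans (∣∁p∣≡n∸∣p∣ (∁ u)) (cong (4 ∸_) (trans (∣∁p∣≡n∸∣p∣ u) (cong (4 ∸_) eq)))
... | .u | refl | e = cong (u ,_) (≡-irrelevant e eq)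

ϰ↔ : ℘₂ ↔ ℘₂
ϰ↔ = mk↔ₛ′ ϰ ϰ ϰ-involutive ϰ-involutive

-- A family of four 3-element subsets of ℘₂ ("lines"), line l being
-- the set {N l 0, N l 1, N l 2}.
Family : Set
Family = Fin 4 → Fin 3 → ℘₂

_∈L_ : ℘₂ → (Fin 3 → ℘₂) → Set
u ∈L L = ∃ λ k → L k ≡ u

record IsVeblen (N : Family) : Set where
  field
    three-element : ∀ l (k k′ : Fin 3) → N l k ≡ N l k′ → k ≡ k′
    on-two-lines  : ∀ (u : ℘₂) → Σ (Fin 4) λ l₁ → Σ (Fin 4) λ l₂ →
                      l₁ ≢ l₂ × u ∈L N l₁ × u ∈L N l₂ ×
                      (∀ l → u ∈L N l → l ≡ l₁ ⊎ l ≡ l₂)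
    meet-once     : ∀ (l l′ : Fin 4) → l ≢ l′ →
                      ∃! _≡_ λ (u : ℘₂) → u ∈L N l × u ∈L N l′

ϰN : Family → Family
ϰN N l k = ϰ (N l k)

data Pt : Set where
  p : Pt
  a : I₄ → Pt
  b : I₄ → Pt
  c : ℘₂ → Pt

data Gen (δ : ℘₂ ↔ ℘₂) (N : Family) : Pt → Pt → Pt → Set where
  cline : ∀ l → Gen δ N (c (N l zero)) (c (N l (suc zero))) (c (N l (suc (suc zero))))
  aline : ∀ (u : ℘₂) (i j : I₄) → i ≢ j → i ∈ proj₁ u → j ∈ proj₁ u →
            Gen δ N (a i) (a j) (c u)
  bline : ∀ (u : ℘₂) (i j : I₄) → i ≢ j → i ∈ proj₁ u → j ∈ proj₁ u →
            Gen δ N (b i) (b j) (c (Inverse.from δ u))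
  pline : ∀ (i : I₄) → Gen δ N p (a i) (b i)

-- {x,y,z} is a line of Π(p, δ, N) (lines are unordered: any ordering of a
-- generating triple).
IsLine : (δ : ℘₂ ↔ ℘₂) (N : Family) → Pt → Pt → Pt → Set
IsLine δ N x y z =
  Gen δ N x y z ⊎ Gen δ N x z y ⊎ Gen δ N y x z ⊎
  Gen δ N y z x ⊎ Gen δ N z x y ⊎ Gen δ N z y x

-- f is an isomorphism Π(p,δ,N) → Π(p,δ′,N′): a bijection of points such that
-- a triple is a line of the source iff its image is a line of the target
-- (for a bijection this is exactly "maps the lines onto the lines").
IsIsomorphism : (δ : ℘₂ ↔ ℘₂) (N : Family) (δ′ : ℘₂ ↔ ℘₂) (N′ : Family) →
                (Pt → Pt) → Set
IsIsomorphism δ N δ′ N′ f =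
  Bijective _≡_ _≡_ f ×
  (∀ x y z → (IsLine δ N x y z → IsLine δ′ N′ (f x) (f y) (f z)) ×
             (IsLine δ′ N′ (f x) (f y) (f z) → IsLine δ N x y z))

φ : Pt → Pt
φ p     = p
φ (a i) = b i
φ (b i) = a i
φ (c u) = c (ϰ u)

-- φ swaps the two "halves" a and b of Π(p, ϰ, N): a line {a_i, a_j, c_u}
-- goes to {b_i, b_j, c_{ϰ(u)}}, which is a b-line of Π(p, ϰ, ϰ(N)) because
-- ϰ⁻¹ = ϰ, and symmetrically for b-lines since ϰ is an involution; c-lines
-- go to the lines of ϰ(N) and {p, a_i, b_i} to {p, b_i, a_i}. Applying the
-- same observation to ϰ(N), whose image ϰ(ϰ(N)) is N again, gives the converse
-- direction.
module Submission where

open import Defs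
open import Data.Fin using (zero; suc)
open import Data.Product using (_,_)
open import Data.Sum using (inj₁; inj₂)
open import Function.Bundles using (_↔_; mk↔ₛ′; Bijection)
open import Function.Properties.Inverse using (↔⇒⤖)
open import Relation.Binary.PropositionalEquality using (_≡_; refl; sym; cong)

φ-involutive : ∀ x → φ (φ x) ≡ x
φ-involutive p     = refl
φ-involutive (a i) = refl
φ-involutive (b i) = refl
φ-involutive (c u) = cong c (ϰ-involutive u)

φ↔ : Pt ↔ Pt
φ↔ = mk↔ₛ′ φ φ φ-involutive φ-involutive

module _ {δ : ℘₂ ↔ ℘₂} {N : Family} where

  IsLine-cong : ∀ {x y z x′ y′ z′} → x ≡ x′ → y ≡ y′ → z ≡ z′ →
                IsLine δ N x y z → IsLine δ N x′ y′ z′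
  IsLine-cong refl refl refl ℓ = ℓ

  IsLine-swap₁₂ : ∀ {x y z} → IsLine δ N x y z → IsLine δ N y x z
  IsLine-swap₁₂ (inj₁ g)                               = inj₂ (inj₂ (inj₁ g))
  IsLine-swap₁₂ (inj₂ (inj₁ g))                        = inj₂ (inj₂ (inj₂ (inj₁ g)))
  IsLine-swap₁₂ (inj₂ (inj₂ (inj₁ g)))                 = inj₁ g
  IsLine-swap₁₂ (inj₂ (inj₂ (inj₂ (inj₁ g))))          = inj₂ (inj₁ g)
  IsLine-swap₁₂ (inj₂ (inj₂ (inj₂ (inj₂ (inj₁ g)))))   = inj₂ (inj₂ (inj₂ (inj₂ (inj₂ g))))
  IsLine-swap₁₂ (inj₂ (inj₂ (inj₂ (inj₂ (inj₂ g)))))   = inj₂ (inj₂ (inj₂ (inj₂ (inj₁ g))))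

  IsLine-swap₂₃ : ∀ {x y z} → IsLine δ N x y z → IsLine δ N x z y
  IsLine-swap₂₃ (inj₁ g)                               = inj₂ (inj₁ g)
  IsLine-swap₂₃ (inj₂ (inj₁ g))                        = inj₁ g
  IsLine-swap₂₃ (inj₂ (inj₂ (inj₁ g)))                 = inj₂ (inj₂ (inj₂ (inj₂ (inj₁ g))))
  IsLine-swap₂₃ (inj₂ (inj₂ (inj₂ (inj₁ g))))          = inj₂ (inj₂ (inj₂ (inj₂ (inj₂ g))))
  IsLine-swap₂₃ (inj₂ (inj₂ (inj₂ (inj₂ (inj₁ g)))))   = inj₂ (inj₂ (inj₁ g))
  IsLine-swap₂₃ (inj₂ (inj₂ (inj₂ (inj₂ (inj₂ g)))))   = inj₂ (inj₂ (inj₂ (inj₁ g)))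

IsLine-map : ∀ {δ N δ′ N′} (f : Pt → Pt) →
             (∀ {x y z} → Gen δ N x y z → IsLine δ′ N′ (f x) (f y) (f z)) →
             ∀ {x y z} → IsLine δ N x y z → IsLine δ′ N′ (f x) (f y) (f z)
IsLine-map f gen (inj₁ g)                             = gen g
IsLine-map f gen (inj₂ (inj₁ g))                      = IsLine-swap₂₃ (gen g)
IsLine-map f gen (inj₂ (inj₂ (inj₁ g)))               = IsLine-swap₁₂ (gen g)
IsLine-map f gen (inj₂ (inj₂ (inj₂ (inj₁ g))))        = IsLine-swap₁₂ (IsLine-swap₂₃ (gen g))
IsLine-map f gen (inj₂ (inj₂ (inj₂ (inj₂ (inj₁ g))))) = IsLine-swap₂₃ (IsLine-swap₁₂ (gen g))
IsLine-map f gen (inj₂ (inj₂ (inj₂ (inj₂ (inj₂ g))))) =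
  IsLine-swap₁₂ (IsLine-swap₂₃ (IsLine-swap₁₂ (gen g)))

-- Stated for any N′ that agrees with ϰN N pointwise, so that it also applies
-- to N′ = N and ϰN (ϰN N), which are not definitionally equal.
φ-maps-Gen : ∀ {N N′} → (∀ l k → ϰ (N l k) ≡ N′ l k) →
             ∀ {x y z} → Gen ϰ↔ N x y z → IsLine ϰ↔ N′ (φ x) (φ y) (φ z)
φ-maps-Gen N≡ϰN′ (cline l) =
  IsLine-cong (cong c (sym (N≡ϰN′ l zero)))
              (cong c (sym (N≡ϰN′ l (suc zero))))
              (cong c (sym (N≡ϰN′ l (suc (suc zero)))))
              (inj₁ (cline l))
φ-maps-Gen _ (aline u i j i≢j i∈u j∈u) = inj₁ (bline u i j i≢j i∈u j∈u)
φ-maps-Gen _ (bline u i j i≢j i∈u j∈u) =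
  IsLine-cong refl refl (cong c (sym (ϰ-involutive u)))
              (inj₁ (aline u i j i≢j i∈u j∈u))
φ-maps-Gen _ (pline i) = IsLine-swap₂₃ (inj₁ (pline i))

φ-maps-IsLine : ∀ {N N′} → (∀ l k → ϰ (N l k) ≡ N′ l k) →
                ∀ {x y z} → IsLine ϰ↔ N x y z → IsLine ϰ↔ N′ (φ x) (φ y) (φ z)
φ-maps-IsLine N≡ϰN′ = IsLine-map φ (φ-maps-Gen N≡ϰN′)

lemma4p4 : (N : Family) → IsVeblen N → IsIsomorphism ϰ↔ N ϰ↔ (ϰN N) φ
lemma4p4 N _ = Bijection.bijective (↔⇒⤖ φ↔) , λ x y z →
  φ-maps-IsLine (λ _ _ → refl) ,
  λ ℓ → IsLine-cong (φ-involutive x) (φ-involutive y) (φ-involutive z)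
          (φ-maps-IsLine (λ l k → ϰ-involutive (N l k)) ℓ)
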